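{- For every finite vocabulary $V$, every mental program $\pi$ over $V$ and all $s,t\subseteq V$: $s\xrightarrow{\pi}t$ if and only if $s\cup t'\vDash\mathsf{tr}(\pi)$.
   Context: Mental programs over a finite vocabulary $V$: $\pi::=p\leftarrow\top\mid p\leftarrow\bot\mid\beta?\mid\pi\cup\pi\mid\pi;\pi\mid\pi\cap\pi$ ($p\in V$, $\beta$ a Boolean formula over $V$). For $s,t\subseteq V$: $s\xrightarrow{p\leftarrow\top}t$ iff $t=s\cup\{p\}$; $s\xrightarrow{p\leftarrow\bot}t$ iff $t=s\setminus\{p\}$; $s\xrightarrow{\beta?}t$ iff $s=t$ and $s\vDash\beta$; $\cup$ is union, $\cap$ intersection of relations, and $s\xrightarrow{\pi_1;\pi_2}t$ iff some $u\subseteq V$ has $s\xrightarrow{\pi_1}u$ and $u\xrightarrow{\pi_2}t$. $V'=\{p'\mid p\in V\}$ and $V''=\{p''\mid p\in V\}$ are fresh copies of $V$, $t'=\{p'\mid p\in t\}$; Boolean formulas over $V\cup V'$ are evaluated at subsets of $V\cup V'$. $[A\mapsto B]\phi$ is simultaneous substitution via the evident bijection; $\exists p\,\phi:=[p\mapsto\top]\phi\lor[p\mapsto\bot]\phi$, extended to sets. The translation $\mathsf{tr}$ to Boolean formulas over $V\cup V'$: $\mathsf{tr}(p\leftarrow\top)=p'\land\bigwedge_{q\in V,q\neq p}(q\leftrightarrow q')$; $\mathsf{tr}(p\leftarrow\bot)=\neg p'\land\bigwedge_{q\in V,q\neq p}(q\leftrightarrow q')$; $\mathsf{tr}(\beta?)=\beta\land\bigwedge_{p\in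 V}(p\leftrightarrow p')$; $\mathsf{tr}(\pi_1\cup\pi_2)=\mathsf{tr}(\pi_1)\lor\mathsf{tr}(\pi_2)$; $\mathsf{tr}(\pi_1\cap\pi_2)=\mathsf{tr}(\pi_1)\land\mathsf{tr}(\pi_2)$; $\mathsf{tr}(\pi_1;\pi_2)=[V''\mapsto V'](\exists V'(\mathsf{tr}(\pi_1)\land\mathsf{tr}(\pi_2)'))$, where $\mathsf{tr}(\pi_2)'$ is obtained from $\mathsf{tr}(\pi_2)$ by simultaneously replacing each $p\in V$ by $p'$ and each $p'\in V'$ by $p''$. -}

module Defs where

open import Data.Nat using (ℕ)
open import Data.Fin using (Fin; _≟_)
open import Data.Fin.Subset using (Subset; ⁅_⁆; _-_) renaming (_∪_ to _∪ˢ_)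
open import Data.Vec using (lookup)
open import Data.Bool using (Bool; true; false; not; if_then_else_)
  renaming (_∧_ to _∧ᵇ_; _∨_ to _∨ᵇ_)
open import Data.Sum using (_⊎_; inj₁; inj₂; [_,_])
open import Data.Product using (Σ; _×_)
open import Data.List using (List; foldr)
open import Data.List using () renaming (map to mapL)
open import Data.Fin using () renaming (zero to fz)
open import Data.List.Base using ()
open import Data.Vec using () renaming (allFin to allFinV; toList to vecToList)
open import Relation.Binary.PropositionalEquality using (_≡_)
open import Relation.Nullary using (yes; no)

data Form (A : Set) : Set where
  atom : A → Form A
  ⊤f ⊥f : Form A
  ¬f_ : Form A → Form A
  _∧f_ _∨f_ _⇒f_ _⇔f_ : Form A → Form A → Form A

infixr 6 _∧f_
infixr 5 _∨f_
infixr 4 _⇒f_ _⇔f_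
infix 7 ¬f_

eval : {A : Set} → (A → Bool) → Form A → Bool
eval v (atom a) = v a
eval v ⊤f = true
eval v ⊥f = false
eval v (¬f φ) = not (eval v φ)
eval v (φ ∧f ψ) = eval v φ ∧ᵇ eval v ψ
eval v (φ ∨f ψ) = eval v φ ∨ᵇ eval v ψ
eval v (φ ⇒f ψ) = not (eval v φ) ∨ᵇ eval v ψ
eval v (φ ⇔f ψ) = if eval v φ then eval v ψ else not (eval v ψ)

_⊨_ : {A : Set} → (A → Bool) → Form A → Set
v ⊨ φ = eval v φ ≡ true

subst : {A B : Set} → (A → Form B) → Form A → Form B
subst σ (atom a) = σ a
subst σ ⊤f = ⊤f
subst σ ⊥f = ⊥f
subst σ (¬f φ) = ¬f subst σ φ
subst σ (φ ∧f ψ) = subst σ φ ∧f subst σ ψ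
subst σ (φ ∨f ψ) = subst σ φ ∨f subst σ ψ
subst σ (φ ⇒f ψ) = subst σ φ ⇒f subst σ ψ
subst σ (φ ⇔f ψ) = subst σ φ ⇔f subst σ ψ

rename : {A B : Set} → (A → B) → Form A → Form B
rename f = subst (λ a → atom (f a))

-- atoms of V ∪ V' : inj₁ p = p,  inj₂ p = p'
Atom2 : ℕ → Set
Atom2 n = Fin n ⊎ Fin n

-- atoms of V ∪ V' ∪ V'' : inj₁ p = p, inj₂ (inj₁ p) = p', inj₂ (inj₂ p) = p''
Atom3 : ℕ → Set
Atom3 n = Fin n ⊎ (Fin n ⊎ Fin n)

allFin : (n : ℕ) → List (Fin n)
allFin n = vecToList (allFinV n)

⋀ : {A : Set} {n : ℕ} → (Fin n → Form A) → Form A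
⋀ {n = n} f = foldr (λ p φ → f p ∧f φ) ⊤f (allFin n)

-- ∃p φ := [p ↦ ⊤]φ ∨ [p ↦ ⊥]φ  for the primed atom p' in Atom3
substV' : {n : ℕ} → Fin n → Form (Atom3 n) → Form (Atom3 n) → Form (Atom3 n)
substV' {n} p χ = subst σ
  where
  σ : Atom3 n → Form (Atom3 n)
  σ (inj₂ (inj₁ q)) with q ≟ p
  ... | yes _ = χ
  ... | no _ = atom (inj₂ (inj₁ q))
  σ a = atom a

∃V'1 : {n : ℕ} → Fin n → Form (Atom3 n) → Form (Atom3 n)
∃V'1 p φ = substV' p ⊤f φ ∨f substV' p ⊥f φ

∃V' : {n : ℕ} → Form (Atom3 n) → Form (Atom3 n)
∃V' {n} φ = foldr ∃V'1 φ (allFin n)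

emb : {n : ℕ} → Atom2 n → Atom3 n
emb (inj₁ p) = inj₁ p
emb (inj₂ p) = inj₂ (inj₁ p)

prime : {n : ℕ} → Atom2 n → Atom3 n
prime (inj₁ p) = inj₂ (inj₁ p)
prime (inj₂ p) = inj₂ (inj₂ p)

-- [V'' ↦ V'] (identity on V; V' atoms are kept as V', they no longer occur
-- after ∃V')
V''↦V' : {n : ℕ} → Atom3 n → Atom2 n
V''↦V' (inj₁ p) = inj₁ p
V''↦V' (inj₂ (inj₁ p)) = inj₂ p
V''↦V' (inj₂ (inj₂ p)) = inj₂ p

data Prog (n : ℕ) : Set where
  _←⊤ _←⊥ : Fin n → Prog n
  _¿ : Form (Fin n) → Prog n
  _∪p_ _︔_ _∩p_ : Prog n → Prog n → Prog n

_⟶[_]_ : {n : ℕ} → Subset n → Prog n → Subset n → Set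
s ⟶[ p ←⊤ ] t = t ≡ s ∪ˢ ⁅ p ⁆
s ⟶[ p ←⊥ ] t = t ≡ s - p
s ⟶[ β ¿ ] t = (s ≡ t) × (lookup s ⊨ β)
s ⟶[ π₁ ∪p π₂ ] t = (s ⟶[ π₁ ] t) ⊎ (s ⟶[ π₂ ] t)
s ⟶[ π₁ ∩p π₂ ] t = (s ⟶[ π₁ ] t) × (s ⟶[ π₂ ] t)
_⟶[_]_ {n} s (π₁ ︔ π₂) t = Σ (Subset n) λ u → (s ⟶[ π₁ ] u) × (u ⟶[ π₂ ] t)

same : {n : ℕ} → Fin n → Form (Atom2 n)
same q = atom (inj₁ q) ⇔f atom (inj₂ q)

sameExcept : {n : ℕ} → Fin n → Form (Atom2 n)
sameExcept p = ⋀ λ q → f q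
  where
  f : _ → _
  f q with q ≟ p
  ... | yes _ = ⊤f
  ... | no _ = same q

tr : {n : ℕ} → Prog n → Form (Atom2 n)
tr (p ←⊤) = atom (inj₂ p) ∧f sameExcept p
tr (p ←⊥) = (¬f atom (inj₂ p)) ∧f sameExcept p
tr (β ¿) = rename inj₁ β ∧f ⋀ same
tr (π₁ ∪p π₂) = tr π₁ ∨f tr π₂
tr (π₁ ∩p π₂) = tr π₁ ∧f tr π₂
tr (π₁ ︔ π₂) = rename V''↦V' (∃V' (rename emb (tr π₁) ∧f rename prime (tr π₂)))

_∪′_ : {n : ℕ} → Subset n → Subset n → Atom2 n → Bool
s ∪′ t = [ lookup s , lookup t ]

-- An assignment p ← b becomes the literal
-- on p′ together with the frame condition q ↔ q′ for q ≠ p, which at s ∪ t′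
-- says exactly t = s[p ≔ b]; a test adds the full frame condition, i.e.
-- s = t.  For π₁ ; π₂ the intermediate state u lives on the copy V′: the
-- quantifier ∃V′ ranges over all u, and after [V″ ↦ V′] the valuation is
-- s on V, u on V′ and t on V″, so the two conjuncts read s →π₁ u and u →π₂ t.

module Submission where

open import Defs
open import Data.Nat using (ℕ)
open import Data.Fin.Subset using (Subset)
open import Data.Product using (_×_)

open import Data.Bool using (Bool; true; false; not; if_then_else_; _∧_; _∨_)
open import Data.Bool.Properties using (T-≡; T-not-≡; T-∧; T-∨; ∨-zeroʳ; ∨-identityʳ)
open import Data.Empty using (⊥-elim)
open import Data.Fin using (Fin; zero; suc; _≟_)
open import Data.Fin.Subset using (⁅_⁆; _-_) renaming (_∪_ to _∪ˢ_)
open import Data.Fin.Subset.Properties using (∪-identityʳ; p─⊥≡p)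
open import Data.List using (List; []; _∷_; foldr)
open import Data.List.Membership.Propositional using (_∈_)
open import Data.List.Relation.Unary.All as All using (All; []; _∷_)
open import Data.List.Relation.Unary.Any using (here; there)
open import Data.Product using (∃-syntax; _,_; uncurry; swap)
open import Data.Product.Function.NonDependent.Propositional using (_×-⇔_)
import Data.Product.Function.Dependent.Propositional as Σ
open import Data.Sum using (_⊎_; inj₁; inj₂)
open import Data.Sum.Function.Propositional using (_⊎-⇔_)
open import Data.Vec using (_∷_; lookup; tabulate; _[_]≔_)
open import Data.Vec.Membership.Propositional.Properties using (∈-allFin⁺; ∈-toList⁺)
open import Data.Vec.Properties using (lookup∘update; lookup∘update′; lookup∘tabulate)
open import Data.Vec.Relation.Binary.Pointwise.Extensional using (ext; Pointwise-≡⇒≡)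
open import Function.Bundles using (_⇔_; mk⇔; Equivalence)
open import Function.Properties.Equivalence using () renaming (refl to ⇔-refl; sym to ⇔-sym; trans to ⇔-trans)
open import Relation.Binary.PropositionalEquality
  using (_≡_; _≢_; refl; sym; trans; cong; cong₂)
open import Relation.Nullary using (¬_; yes; no)

open Equivalence using (to; from)

private
  variable
    A B : Set
    n : ℕ
    a b : Bool
    v w : A → Bool

∧≡true⇔ : a ∧ b ≡ true ⇔ (a ≡ true × b ≡ true)
∧≡true⇔ = ⇔-trans (⇔-sym T-≡) (⇔-trans T-∧ (T-≡ ×-⇔ T-≡))

∨≡true⇔ : a ∨ b ≡ true ⇔ (a ≡ true ⊎ b ≡ true)
∨≡true⇔ = ⇔-trans (⇔-sym T-≡) (⇔-trans T-∨ (T-≡ ⊎-⇔ T-≡))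

not≡true⇔ : not a ≡ true ⇔ a ≡ false
not≡true⇔ = ⇔-trans (⇔-sym T-≡) T-not-≡

iff≡true⇔ : (if a then b else not b) ≡ true ⇔ a ≡ b
iff≡true⇔ = mk⇔ ⇒ ⇐
  where
  ⇒ : (if a then b else not b) ≡ true → a ≡ b
  ⇒ {true}  {true}  _ = refl
  ⇒ {false} {false} _ = refl
  ⇐ : a ≡ b → (if a then b else not b) ≡ true
  ⇐ {true}  refl = refl
  ⇐ {false} refl = refl

⊨-∧ : (φ ψ : Form A) → v ⊨ (φ ∧f ψ) ⇔ (v ⊨ φ × v ⊨ ψ)
⊨-∧ _ _ = ∧≡true⇔

⊨-∨ : (φ ψ : Form A) → v ⊨ (φ ∨f ψ) ⇔ (v ⊨ φ ⊎ v ⊨ ψ)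
⊨-∨ _ _ = ∨≡true⇔

eval-cong : (∀ x → v x ≡ w x) → (φ : Form A) → eval v φ ≡ eval w φ
eval-cong v≗w (atom x) = v≗w x
eval-cong v≗w ⊤f = refl
eval-cong v≗w ⊥f = refl
eval-cong v≗w (¬f φ) = cong not (eval-cong v≗w φ)
eval-cong v≗w (φ ∧f ψ) = cong₂ _∧_ (eval-cong v≗w φ) (eval-cong v≗w ψ)
eval-cong v≗w (φ ∨f ψ) = cong₂ _∨_ (eval-cong v≗w φ) (eval-cong v≗w ψ)
eval-cong v≗w (φ ⇒f ψ) = cong₂ (λ x y → not x ∨ y) (eval-cong v≗w φ) (eval-cong v≗w ψ)
eval-cong v≗w (φ ⇔f ψ) =
  cong₂ (λ x y → if x then y else not y) (eval-cong v≗w φ) (eval-cong v≗w ψ)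

⊨-cong : (φ : Form A) → (∀ x → v x ≡ w x) → v ⊨ φ ⇔ w ⊨ φ
⊨-cong φ v≗w = mk⇔ (trans (sym (eval-cong v≗w φ))) (trans (eval-cong v≗w φ))

eval-subst : (σ : A → Form B) (φ : Form A) → eval v (subst σ φ) ≡ eval (λ x → eval v (σ x)) φ
eval-subst σ (atom x) = refl
eval-subst σ ⊤f = refl
eval-subst σ ⊥f = refl
eval-subst σ (¬f φ) = cong not (eval-subst σ φ)
eval-subst σ (φ ∧f ψ) = cong₂ _∧_ (eval-subst σ φ) (eval-subst σ ψ)
eval-subst σ (φ ∨f ψ) = cong₂ _∨_ (eval-subst σ φ) (eval-subst σ ψ)
eval-subst σ (φ ⇒f ψ) = cong₂ (λ x y → not x ∨ y) (eval-subst σ φ) (eval-subst σ ψ)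
eval-subst σ (φ ⇔f ψ) =
  cong₂ (λ x y → if x then y else not y) (eval-subst σ φ) (eval-subst σ ψ)

⊨-rename : (f : A → B) (φ : Form A) → v ⊨ rename f φ ⇔ (λ x → v (f x)) ⊨ φ
⊨-rename f φ = mk⇔ (trans (sym (eval-subst _ φ))) (trans (eval-subst _ φ))

⊨foldr-∧ : (F : Fin n → Form A) (xs : List (Fin n)) →
  v ⊨ foldr (λ p φ → F p ∧f φ) ⊤f xs ⇔ All (λ q → v ⊨ F q) xs
⊨foldr-∧ F [] = mk⇔ (λ _ → []) (λ _ → refl)
⊨foldr-∧ F (x ∷ xs) = ⇔-trans (⊨-∧ (F x) (foldr (λ p φ → F p ∧f φ) ⊤f xs))
  (⇔-trans (⇔-refl ×-⇔ ⊨foldr-∧ F xs) (mk⇔ (uncurry _∷_) λ { (hx ∷ hxs) → hx , hxs }))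

∈-allFin : (q : Fin n) → q ∈ allFin n
∈-allFin q = ∈-toList⁺ (∈-allFin⁺ q)

⊨⋀ : (F : Fin n → Form A) → v ⊨ ⋀ F ⇔ (∀ q → v ⊨ F q)
⊨⋀ F = mk⇔ (λ h q → All.lookup (to (⊨foldr-∧ F (allFin _)) h) (∈-allFin q))
            (λ h → from (⊨foldr-∧ F (allFin _)) (All.tabulate λ {q} _ → h q))

-- The conjuncts of sameExcept are given by a function local to Defs;
-- conjunctOf recovers it by unification.
conjunctOf : {F : Fin n → Form A} (φ : Form A) → φ ≡ ⋀ F → Fin n → Form A
conjunctOf {F = F} _ _ = F

sameExceptAt : Fin n → Fin n → Form (Atom2 n)
sameExceptAt p = conjunctOf (sameExcept p) refl

⊨sameExceptAt : (v : Atom2 n → Bool) (p q : Fin n) →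
  v ⊨ sameExceptAt p q ⇔ (q ≢ p → v (inj₁ q) ≡ v (inj₂ q))
⊨sameExceptAt v p q with q ≟ p
... | yes q≡p = mk⇔ (λ _ q≢p → ⊥-elim (q≢p q≡p)) (λ _ → refl)
... | no q≢p = mk⇔ (λ h _ → to iff≡true⇔ h) (λ h → from iff≡true⇔ (h q≢p))

⊨sameExcept : (v : Atom2 n → Bool) (p : Fin n) →
  v ⊨ sameExcept p ⇔ (∀ q → q ≢ p → v (inj₁ q) ≡ v (inj₂ q))
⊨sameExcept v p = ⇔-trans (⊨⋀ (sameExceptAt p))
  (mk⇔ (λ h q → to (⊨sameExceptAt v p q) (h q)) (λ h q → from (⊨sameExceptAt v p q) (h q)))

≡[]≔⇔ : {s t : Subset n} {p : Fin n} →
  t ≡ s [ p ]≔ b ⇔ (lookup t p ≡ b × (∀ q → q ≢ p → lookup s q ≡ lookup t q))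
≡[]≔⇔ {b = b} {s = s} {t} {p} = mk⇔ ⇒ ⇐
  where
  ⇒ : t ≡ s [ p ]≔ b → lookup t p ≡ b × (∀ q → q ≢ p → lookup s q ≡ lookup t q)
  ⇒ refl = lookup∘update p s b , λ q q≢p → sym (lookup∘update′ q≢p s b)
  ⇐ : lookup t p ≡ b × (∀ q → q ≢ p → lookup s q ≡ lookup t q) → t ≡ s [ p ]≔ b
  ⇐ (tp≡b , s≗t) = Pointwise-≡⇒≡ (ext pointwise)
    where
    pointwise : ∀ q → lookup t q ≡ lookup (s [ p ]≔ b) q
    pointwise q with q ≟ p
    ... | yes refl = trans tp≡b (sym (lookup∘update p s b))
    ... | no q≢p = trans (sym (s≗t q q≢p)) (sym (lookup∘update′ q≢p s b))

∪⁅⁆≡[]≔true : (s : Subset n) (p : Fin n) → s ∪ˢ ⁅ p ⁆ ≡ s [ p ]≔ true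
∪⁅⁆≡[]≔true (x ∷ s) zero = cong₂ _∷_ (∨-zeroʳ x) (∪-identityʳ s)
∪⁅⁆≡[]≔true (x ∷ s) (suc p) = cong₂ _∷_ (∨-identityʳ x) (∪⁅⁆≡[]≔true s p)

-≡[]≔false : (s : Subset n) (p : Fin n) → s - p ≡ s [ p ]≔ false
-≡[]≔false (x ∷ s) zero = cong (false ∷_) (p─⊥≡p s)
-≡[]≔false (x ∷ s) (suc p) = cong (x ∷_) (-≡[]≔false s p)

_[_′≔_] : (Atom3 n → Bool) → Fin n → Bool → Atom3 n → Bool
(v [ p ′≔ b ]) (inj₂ (inj₁ q)) with q ≟ p
... | yes _ = b
... | no _ = v (inj₂ (inj₁ q))
(v [ p ′≔ b ]) x = v x

[′≔]-other : (v : Atom3 n → Bool) (p : Fin n) (x : Atom3 n) →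
  x ≢ inj₂ (inj₁ p) → (v [ p ′≔ b ]) x ≡ v x
[′≔]-other v p (inj₁ q) _ = refl
[′≔]-other v p (inj₂ (inj₁ q)) x≢p′ with q ≟ p
... | yes refl = ⊥-elim (x≢p′ refl)
... | no _ = refl
[′≔]-other v p (inj₂ (inj₂ q)) _ = refl

eval-substV' : (v : Atom3 n → Bool) (p : Fin n) (χ φ : Form (Atom3 n)) →
  eval v (substV' p χ φ) ≡ eval (v [ p ′≔ eval v χ ]) φ
eval-substV' v p χ φ = trans (eval-subst _ φ) (eval-cong substV'-atom φ)
  where
  substV'-atom : ∀ x → eval v (substV' p χ (atom x)) ≡ (v [ p ′≔ eval v χ ]) x
  substV'-atom (inj₁ q) = refl
  substV'-atom (inj₂ (inj₁ q)) with q ≟ p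
  ... | yes _ = refl
  ... | no _ = refl
  substV'-atom (inj₂ (inj₂ q)) = refl

⊨∃V'1 : (v : Atom3 n → Bool) (p : Fin n) (φ : Form (Atom3 n)) →
  v ⊨ ∃V'1 p φ ⇔ (∃[ b ] (v [ p ′≔ b ]) ⊨ φ)
⊨∃V'1 v p φ = ⇔-trans (⊨-∨ (substV' p ⊤f φ) (substV' p ⊥f φ))
  (⇔-trans (⊨substV' ⊤f ⊎-⇔ ⊨substV' ⊥f) (mk⇔ ⇒ ⇐))
  where
  ⊨substV' : (χ : Form (Atom3 _)) → v ⊨ substV' p χ φ ⇔ (v [ p ′≔ eval v χ ]) ⊨ φ
  ⊨substV' χ = mk⇔ (trans (sym (eval-substV' v p χ φ))) (trans (eval-substV' v p χ φ))
  ⇒ : (v [ p ′≔ true ]) ⊨ φ ⊎ (v [ p ′≔ false ]) ⊨ φ → ∃[ b ] (v [ p ′≔ b ]) ⊨ φ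
  ⇒ (inj₁ h) = true , h
  ⇒ (inj₂ h) = false , h
  ⇐ : ∃[ b ] (v [ p ′≔ b ]) ⊨ φ → (v [ p ′≔ true ]) ⊨ φ ⊎ (v [ p ′≔ false ]) ⊨ φ
  ⇐ (true , h) = inj₁ h
  ⇐ (false , h) = inj₂ h

_∈′_ : Atom3 n → List (Fin n) → Set
x ∈′ xs = ∃[ q ] q ∈ xs × x ≡ inj₂ (inj₁ q)

_≈[_]_ : (Atom3 n → Bool) → List (Fin n) → (Atom3 n → Bool) → Set
v ≈[ xs ] w = ∀ x → ¬ x ∈′ xs → v x ≡ w x

⊨foldr-∃V'1⇒ : (xs : List (Fin n)) (φ : Form (Atom3 n)) (v : Atom3 n → Bool) →
  v ⊨ foldr ∃V'1 φ xs → ∃[ w ] v ≈[ xs ] w × w ⊨ φ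
⊨foldr-∃V'1⇒ [] φ v h = v , (λ _ _ → refl) , h
⊨foldr-∃V'1⇒ (p ∷ xs) φ v h with to (⊨∃V'1 v p (foldr ∃V'1 φ xs)) h
... | b , h′ with ⊨foldr-∃V'1⇒ xs φ (v [ p ′≔ b ]) h′
... | w , v′≈w , w⊨φ = w , v≈w , w⊨φ
  where
  v≈w : v ≈[ p ∷ xs ] w
  v≈w x x∉ = trans (sym ([′≔]-other v p x λ x≡p′ → x∉ (p , here refl , x≡p′)))
                   (v′≈w x λ { (q , q∈xs , x≡q′) → x∉ (q , there q∈xs , x≡q′) })

⊨foldr-∃V'1⇐ : (xs : List (Fin n)) (φ : Form (Atom3 n)) (v w : Atom3 n → Bool) →
  v ≈[ xs ] w → w ⊨ φ → v ⊨ foldr ∃V'1 φ xs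
⊨foldr-∃V'1⇐ [] φ v w v≈w w⊨φ =
  from (⊨-cong φ λ x → v≈w x λ { (_ , () , _) }) w⊨φ
⊨foldr-∃V'1⇐ (p ∷ xs) φ v w v≈w w⊨φ =
  from (⊨∃V'1 v p (foldr ∃V'1 φ xs)) (w p′ , ⊨foldr-∃V'1⇐ xs φ (v [ p ′≔ w p′ ]) w v′≈w w⊨φ)
  where
  p′ : Atom3 _
  p′ = inj₂ (inj₁ p)
  v′≈w : (v [ p ′≔ w p′ ]) ≈[ xs ] w
  v′≈w (inj₁ q) _ = v≈w (inj₁ q) λ { (_ , _ , ()) }
  v′≈w (inj₂ (inj₂ q)) _ = v≈w (inj₂ (inj₂ q)) λ { (_ , _ , ()) }
  v′≈w (inj₂ (inj₁ q)) q′∉ with q ≟ p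
  ... | yes refl = refl
  ... | no q≢p = v≈w (inj₂ (inj₁ q)) λ
    { (_ , here refl , refl) → q≢p refl
    ; (r , there r∈xs , eq) → q′∉ (r , r∈xs , eq) }

_[V′≔_] : (Atom3 n → Bool) → Subset n → Atom3 n → Bool
(v [V′≔ u ]) (inj₂ (inj₁ q)) = lookup u q
(v [V′≔ u ]) x = v x

⊨∃V' : (v : Atom3 n → Bool) (φ : Form (Atom3 n)) →
  v ⊨ ∃V' φ ⇔ (∃[ u ] (v [V′≔ u ]) ⊨ φ)
⊨∃V' {n} v φ = mk⇔ ⇒ ⇐
  where
  ⇒ : v ⊨ ∃V' φ → ∃[ u ] (v [V′≔ u ]) ⊨ φ
  ⇒ h with ⊨foldr-∃V'1⇒ (allFin n) φ v h
  ... | w , v≈w , w⊨φ = u , to (⊨-cong φ w≗v′) w⊨φ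
    where
    u : Subset n
    u = tabulate λ q → w (inj₂ (inj₁ q))
    w≗v′ : ∀ x → w x ≡ (v [V′≔ u ]) x
    w≗v′ (inj₁ q) = sym (v≈w (inj₁ q) λ { (_ , _ , ()) })
    w≗v′ (inj₂ (inj₁ q)) = sym (lookup∘tabulate _ q)
    w≗v′ (inj₂ (inj₂ q)) = sym (v≈w (inj₂ (inj₂ q)) λ { (_ , _ , ()) })
  ⇐ : ∃[ u ] (v [V′≔ u ]) ⊨ φ → v ⊨ ∃V' φ
  ⇐ (u , h) = ⊨foldr-∃V'1⇐ (allFin n) φ v (v [V′≔ u ]) v≈v′ h
    where
    v≈v′ : v ≈[ allFin n ] (v [V′≔ u ])
    v≈v′ (inj₁ q) _ = refl
    v≈v′ (inj₂ (inj₁ q)) q′∉ = ⊥-elim (q′∉ (q , ∈-allFin q , refl))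
    v≈v′ (inj₂ (inj₂ q)) _ = refl

⊨literal∧sameExcept : (s t : Subset n) (p : Fin n) (ℓ : Form (Atom2 n)) →
  (s ∪′ t) ⊨ ℓ ⇔ (lookup t p ≡ b) →
  (s ∪′ t) ⊨ (ℓ ∧f sameExcept p) ⇔ (t ≡ s [ p ]≔ b)
⊨literal∧sameExcept s t p ℓ ℓ⇔ = ⇔-trans (⊨-∧ ℓ (sameExcept p))
  (⇔-trans (ℓ⇔ ×-⇔ ⊨sameExcept (s ∪′ t) p) (⇔-sym (≡[]≔⇔ {s = s} {t} {p})))

⊨⋀same : (s t : Subset n) → (s ∪′ t) ⊨ ⋀ same ⇔ s ≡ t
⊨⋀same s t = ⇔-trans (⊨⋀ same) (mk⇔
  (λ h → Pointwise-≡⇒≡ (ext λ q → to iff≡true⇔ (h q)))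
  (λ { refl q → from (iff≡true⇔ {lookup s q}) refl }))

⊨tr-¿ : (s t : Subset n) (β : Form (Fin n)) →
  (s ∪′ t) ⊨ tr (β ¿) ⇔ ((s ≡ t) × lookup s ⊨ β)
⊨tr-¿ s t β = ⇔-trans (⊨-∧ (rename inj₁ β) (⋀ same))
  (⇔-trans (⊨-rename inj₁ β ×-⇔ ⊨⋀same s t) (mk⇔ swap swap))

⊨tr-︔ : (s t : Subset n) (π₁ π₂ : Prog n) →
  (s ∪′ t) ⊨ tr (π₁ ︔ π₂) ⇔ (∃[ u ] (s ∪′ u) ⊨ tr π₁ × (u ∪′ t) ⊨ tr π₂)
⊨tr-︔ {n} s t π₁ π₂ =
  ⇔-trans (⊨-rename V''↦V' (∃V' body)) (⇔-trans (⊨∃V' _ body) (Σ.congˡ ⊨body))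
  where
  body : Form (Atom3 n)
  body = rename emb (tr π₁) ∧f rename prime (tr π₂)
  through : Subset n → Atom3 n → Bool
  through u = (λ x → (s ∪′ t) (V''↦V' x)) [V′≔ u ]
  ⊨body : {u : Subset n} →
    through u ⊨ body ⇔ ((s ∪′ u) ⊨ tr π₁ × (u ∪′ t) ⊨ tr π₂)
  ⊨body = ⇔-trans (⊨-∧ (rename emb (tr π₁)) (rename prime (tr π₂)))
    (⇔-trans (⊨-rename emb (tr π₁)) (⊨-cong (tr π₁) λ { (inj₁ _) → refl ; (inj₂ _) → refl })
     ×-⇔ ⇔-trans (⊨-rename prime (tr π₂)) (⊨-cong (tr π₂) λ { (inj₁ _) → refl ; (inj₂ _) → refl }))

tr-correct : (π : Prog n) {s t : Subset n} → s ⟶[ π ] t ⇔ (s ∪′ t) ⊨ tr π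
tr-correct (p ←⊤) {s} {t} rewrite ∪⁅⁆≡[]≔true s p =
  ⇔-sym (⊨literal∧sameExcept s t p (atom (inj₂ p)) ⇔-refl)
tr-correct (p ←⊥) {s} {t} rewrite -≡[]≔false s p =
  ⇔-sym (⊨literal∧sameExcept s t p (¬f atom (inj₂ p)) not≡true⇔)
tr-correct (β ¿) {s} {t} = ⇔-sym (⊨tr-¿ s t β)
tr-correct (π₁ ∪p π₂) = ⇔-trans (tr-correct π₁ ⊎-⇔ tr-correct π₂) (⇔-sym (⊨-∨ (tr π₁) (tr π₂)))
tr-correct (π₁ ∩p π₂) = ⇔-trans (tr-correct π₁ ×-⇔ tr-correct π₂) (⇔-sym (⊨-∧ (tr π₁) (tr π₂)))
tr-correct (π₁ ︔ π₂) {s} {t} =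
  ⇔-trans (Σ.congˡ (tr-correct π₁ ×-⇔ tr-correct π₂)) (⇔-sym (⊨tr-︔ s t π₁ π₂))

theorem12 : (n : ℕ) (π : Prog n) (s t : Subset n) →
    ((s ⟶[ π ] t) → ((s ∪′ t) ⊨ tr π)) × (((s ∪′ t) ⊨ tr π) → (s ⟶[ π ] t))
theorem12 n π s t = to (tr-correct π {s} {t}) , from (tr-correct π {s} {t})
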